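{- If $(\Gamma, \top; \Delta) \vdash^{*} C$ or $(\Gamma; \Delta, \bot) \vdash^{*} C$ is derivable in SC2Int with a height of derivation at most $n$, then so is $(\Gamma; \Delta) \vdash^{*} C$.
   Context: The language of the bi-intuitionistic logic 2Int is $A ::= p \mid \bot \mid \top \mid (A \wedge A) \mid (A \vee A) \mid (A \rightarrow A) \mid (A \mathbin{ -\!\!<} A)$, where $A \mathbin{ -\!\!<} B$ is co-implication (read "$B$ co-implies $A$"). Sequents have the form $(\Gamma; \Delta) \vdash^{*} C$ with $* \in \{+,-\}$, where $\Gamma$ (assumptions) and $\Delta$ (counterassumptions) are finite, possibly empty multisets. The calculus SC2Int has the following rules (for $* \in \{+,-\}$, $p$ atomic). Zero-premise rules: $(\Gamma, p; \Delta) \vdash^{+} p$; $(\Gamma; \Delta, p) \vdash^{ - } p$; $(\Gamma, \bot; \Delta) \vdash^{*} C$; $(\Gamma; \Delta, \top) \vdash^{*} C$; $(\Gamma; \Delta) \vdash^{ - } \bot$; $(\Gamma; \Delta) \vdash^{+} \top$. $\wedge R^{+}$: from $(\Gamma;\Delta)\vdash^{+}A$ and $(\Gamma;\Delta)\vdash^{+}B$ infer $(\Gamma;\Delta)\vdash^{+}A\wedge B$; $\wedge R^{ - }_{1,2}$: from $(\Gamma;\Delta)\vdash^{ - }A$ (resp. $B$) infer $(\Gamma;\Delta)\vdash^{ - }A\wedge B$; $\wedge L^{a}$: from $(\Gamma,A,B;\Delta)\vdash^{*}C$ infer $(\Gamma,A\wedge B;\Delta)\vdash^{*}C$; $\wedge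 L^{c}$: from $(\Gamma;\Delta,A)\vdash^{*}C$ and $(\Gamma;\Delta,B)\vdash^{*}C$ infer $(\Gamma;\Delta,A\wedge B)\vdash^{*}C$. $\vee R^{+}_{1,2}$: from $(\Gamma;\Delta)\vdash^{+}A$ (resp. $B$) infer $(\Gamma;\Delta)\vdash^{+}A\vee B$; $\vee R^{ - }$: from $(\Gamma;\Delta)\vdash^{ - }A$ and $(\Gamma;\Delta)\vdash^{ - }B$ infer $(\Gamma;\Delta)\vdash^{ - }A\vee B$; $\vee L^{a}$: from $(\Gamma,A;\Delta)\vdash^{*}C$ and $(\Gamma,B;\Delta)\vdash^{*}C$ infer $(\Gamma,A\vee B;\Delta)\vdash^{*}C$; $\vee L^{c}$: from $(\Gamma;\Delta,A,B)\vdash^{*}C$ infer $(\Gamma;\Delta,A\vee B)\vdash^{*}C$. $\rightarrow R^{+}$: from $(\Gamma,A;\Delta)\vdash^{+}B$ infer $(\Gamma;\Delta)\vdash^{+}A\rightarrow B$; $\rightarrow R^{ - }$: from $(\Gamma;\Delta)\vdash^{+}A$ and $(\Gamma;\Delta)\vdash^{ - }B$ infer $(\Gamma;\Delta)\vdash^{ - }A\rightarrow B$; $\rightarrow L^{a}$: from $(\Gamma,A\rightarrow B;\Delta)\vdash^{+}A$ and $(\Gamma,B;\Delta)\vdash^{*}C$ infer $(\Gamma,A\rightarrow B;\Delta)\vdash^{*}C$; $\rightarrow L^{c}$: from $(\Gamma,A;\Delta,B)\vdash^{*}C$ infer $(\Gamma;\Delta,A\rightarrow B)\vdash^{*}C$.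 Co-implication right $+$: from $(\Gamma;\Delta)\vdash^{+}A$ and $(\Gamma;\Delta)\vdash^{ - }B$ infer $(\Gamma;\Delta)\vdash^{+}A\mathbin{ -\!\!<}B$; right $-$: from $(\Gamma;\Delta,B)\vdash^{ - }A$ infer $(\Gamma;\Delta)\vdash^{ - }A\mathbin{ -\!\!<}B$; left $a$: from $(\Gamma,A;\Delta,B)\vdash^{*}C$ infer $(\Gamma,A\mathbin{ -\!\!<}B;\Delta)\vdash^{*}C$; left $c$: from $(\Gamma;\Delta,A\mathbin{ -\!\!<}B)\vdash^{ - }B$ and $(\Gamma;\Delta,A)\vdash^{*}C$ infer $(\Gamma;\Delta,A\mathbin{ -\!\!<}B)\vdash^{*}C$. The height of a derivation is the greatest number of successive rule applications in it, zero-premise rules having height 0. -}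

module Defs where

open import Data.Nat using (ℕ; zero; suc; _⊔_)
open import Data.List using (List; []; _∷_)
open import Data.List.Relation.Binary.Permutation.Propositional using (_↭_)

-- Formulas of 2Int; atoms indexed by ℕ.  A -< B is co-implication.
data Form : Set where
  atom : ℕ → Form
  ⊥′ ⊤′ : Form
  _∧′_ _∨′_ _⇒_ _-<_ : Form → Form → Form

data Pol : Set where
  + - : Pol

-- Multisets are represented as lists; a multiset with distinguished element
-- A is any list Γ with Γ ↭ A ∷ Γ' (permutation), so that order is irrelevant.
Ctx : Set
Ctx = List Form

data _⨾_⊢[_]_ : Ctx → Ctx → Pol → Form → Set where
  ax⁺ : ∀ {Γ Γ' Δ p} → Γ ↭ atom p ∷ Γ' → Γ ⨾ Δ ⊢[ + ] atom p
  ax⁻ : ∀ {Γ Δ Δ' p} → Δ ↭ atom p ∷ Δ' → Γ ⨾ Δ ⊢[ - ] atom p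
  ⊥L  : ∀ {Γ Γ' Δ s C} → Γ ↭ ⊥′ ∷ Γ' → Γ ⨾ Δ ⊢[ s ] C
  ⊤L  : ∀ {Γ Δ Δ' s C} → Δ ↭ ⊤′ ∷ Δ' → Γ ⨾ Δ ⊢[ s ] C
  ⊥R⁻ : ∀ {Γ Δ} → Γ ⨾ Δ ⊢[ - ] ⊥′
  ⊤R⁺ : ∀ {Γ Δ} → Γ ⨾ Δ ⊢[ + ] ⊤′
  ∧R⁺  : ∀ {Γ Δ A B} → Γ ⨾ Δ ⊢[ + ] A → Γ ⨾ Δ ⊢[ + ] B → Γ ⨾ Δ ⊢[ + ] (A ∧′ B)
  ∧R⁻₁ : ∀ {Γ Δ A B} → Γ ⨾ Δ ⊢[ - ] A → Γ ⨾ Δ ⊢[ - ] (A ∧′ B)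
  ∧R⁻₂ : ∀ {Γ Δ A B} → Γ ⨾ Δ ⊢[ - ] B → Γ ⨾ Δ ⊢[ - ] (A ∧′ B)
  ∧Lᵃ  : ∀ {Γ Γ' Δ s C A B} → Γ ↭ (A ∧′ B) ∷ Γ' →
         (A ∷ B ∷ Γ') ⨾ Δ ⊢[ s ] C → Γ ⨾ Δ ⊢[ s ] C
  ∧Lᶜ  : ∀ {Γ Δ Δ' s C A B} → Δ ↭ (A ∧′ B) ∷ Δ' →
         Γ ⨾ (A ∷ Δ') ⊢[ s ] C → Γ ⨾ (B ∷ Δ') ⊢[ s ] C → Γ ⨾ Δ ⊢[ s ] C
  ∨R⁺₁ : ∀ {Γ Δ A B} → Γ ⨾ Δ ⊢[ + ] A → Γ ⨾ Δ ⊢[ + ] (A ∨′ B)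
  ∨R⁺₂ : ∀ {Γ Δ A B} → Γ ⨾ Δ ⊢[ + ] B → Γ ⨾ Δ ⊢[ + ] (A ∨′ B)
  ∨R⁻  : ∀ {Γ Δ A B} → Γ ⨾ Δ ⊢[ - ] A → Γ ⨾ Δ ⊢[ - ] B → Γ ⨾ Δ ⊢[ - ] (A ∨′ B)
  ∨Lᵃ  : ∀ {Γ Γ' Δ s C A B} → Γ ↭ (A ∨′ B) ∷ Γ' →
         (A ∷ Γ') ⨾ Δ ⊢[ s ] C → (B ∷ Γ') ⨾ Δ ⊢[ s ] C → Γ ⨾ Δ ⊢[ s ] C
  ∨Lᶜ  : ∀ {Γ Δ Δ' s C A B} → Δ ↭ (A ∨′ B) ∷ Δ' →
         Γ ⨾ (A ∷ B ∷ Δ') ⊢[ s ] C → Γ ⨾ Δ ⊢[ s ] C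
  ⇒R⁺ : ∀ {Γ Δ A B} → (A ∷ Γ) ⨾ Δ ⊢[ + ] B → Γ ⨾ Δ ⊢[ + ] (A ⇒ B)
  ⇒R⁻ : ∀ {Γ Δ A B} → Γ ⨾ Δ ⊢[ + ] A → Γ ⨾ Δ ⊢[ - ] B → Γ ⨾ Δ ⊢[ - ] (A ⇒ B)
  ⇒Lᵃ : ∀ {Γ Γ' Δ s C A B} → Γ ↭ (A ⇒ B) ∷ Γ' →
        Γ ⨾ Δ ⊢[ + ] A → (B ∷ Γ') ⨾ Δ ⊢[ s ] C → Γ ⨾ Δ ⊢[ s ] C
  ⇒Lᶜ : ∀ {Γ Δ Δ' s C A B} → Δ ↭ (A ⇒ B) ∷ Δ' →
        (A ∷ Γ) ⨾ (B ∷ Δ') ⊢[ s ] C → Γ ⨾ Δ ⊢[ s ] C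
  -<R⁺ : ∀ {Γ Δ A B} → Γ ⨾ Δ ⊢[ + ] A → Γ ⨾ Δ ⊢[ - ] B → Γ ⨾ Δ ⊢[ + ] (A -< B)
  -<R⁻ : ∀ {Γ Δ A B} → Γ ⨾ (B ∷ Δ) ⊢[ - ] A → Γ ⨾ Δ ⊢[ - ] (A -< B)
  -<Lᵃ : ∀ {Γ Γ' Δ s C A B} → Γ ↭ (A -< B) ∷ Γ' →
         (A ∷ Γ') ⨾ (B ∷ Δ) ⊢[ s ] C → Γ ⨾ Δ ⊢[ s ] C
  -<Lᶜ : ∀ {Γ Δ Δ' s C A B} → Δ ↭ (A -< B) ∷ Δ' →
         Γ ⨾ Δ ⊢[ - ] B → Γ ⨾ (A ∷ Δ') ⊢[ s ] C → Γ ⨾ Δ ⊢[ s ] C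

height : ∀ {Γ Δ s C} → Γ ⨾ Δ ⊢[ s ] C → ℕ
height (ax⁺ _) = 0
height (ax⁻ _) = 0
height (⊥L _) = 0
height (⊤L _) = 0
height ⊥R⁻ = 0
height ⊤R⁺ = 0
height (∧R⁺ d e) = suc (height d ⊔ height e)
height (∧R⁻₁ d) = suc (height d)
height (∧R⁻₂ d) = suc (height d)
height (∧Lᵃ _ d) = suc (height d)
height (∧Lᶜ _ d e) = suc (height d ⊔ height e)
height (∨R⁺₁ d) = suc (height d)
height (∨R⁺₂ d) = suc (height d)
height (∨R⁻ d e) = suc (height d ⊔ height e)
height (∨Lᵃ _ d e) = suc (height d ⊔ height e)
height (∨Lᶜ _ d) = suc (height d)
height (⇒R⁺ d) = suc (height d)
height (⇒R⁻ d e) = suc (height d ⊔ height e)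
height (⇒Lᵃ _ d e) = suc (height d ⊔ height e)
height (⇒Lᶜ _ d) = suc (height d)
height (-<R⁺ d e) = suc (height d ⊔ height e)
height (-<R⁻ d) = suc (height d)
height (-<Lᵃ _ d) = suc (height d)
height (-<Lᶜ _ d e) = suc (height d ⊔ height e)

{-# OPTIONS --safe #-}
-- Neither ⊤ among the assumptions nor ⊥ among the counterassumptions is ever
-- principal in a rule of SC2Int.  So the occurrence can be deleted from every
-- sequent of a derivation, by induction on it: each rule whose principal
-- formula sits on the same side still finds that formula, distinct from the
-- deleted one, in the remaining context, and heights do not grow.
module Submission where

open import Defs
open import Data.Nat using (ℕ; suc; _⊔_; _≤_; z≤n; s≤s)
open import Data.Nat.Properties using (⊔-mono-≤; ≤-trans)
open import Data.List using ([]; _∷_; _++_)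
open import Data.List.Membership.Propositional.Properties using (∈-∃++)
open import Data.List.Relation.Unary.Any using (here; there)
open import Data.List.Relation.Binary.Permutation.Propositional
open import Data.List.Relation.Binary.Permutation.Propositional.Properties
  using (shift; drop-mid; ∈-resp-↭)
open import Data.Product using (Σ; ∃; _×_; _,_; map; zip)
open import Data.Sum using (_⊎_; inj₁; inj₂)
open import Data.Empty using (⊥-elim)
open import Function using (id)
open import Relation.Binary.PropositionalEquality using (refl; sym; _≢_)

↭-distinct-heads : ∀ {x y : Form} {xs ys zs} → xs ↭ x ∷ ys → xs ↭ y ∷ zs → x ≢ y →
                   ∃ λ ws → (ys ↭ y ∷ ws) × (zs ↭ x ∷ ws)
↭-distinct-heads {x} {y} p q x≢y with ∈-resp-↭ p (∈-resp-↭ (↭-sym q) (here refl))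
... | here y≡x = ⊥-elim (x≢y (sym y≡x))
... | there y∈ys with ∈-∃++ y∈ys
...   | as , bs , refl =
  as ++ bs , shift y as bs , drop-mid [] (x ∷ as) (↭-trans (↭-sym q) p)

↭-prep-under : ∀ {x : Form} A {xs ys} → xs ↭ x ∷ ys → A ∷ xs ↭ x ∷ A ∷ ys
↭-prep-under A p = ↭-trans (prep A p) (swap A _ refl)

suc-⊔-mono-≤ : ∀ {a b c d} → a ≤ b → c ≤ d → suc (a ⊔ c) ≤ suc (b ⊔ d)
suc-⊔-mono-≤ a≤b c≤d = s≤s (⊔-mono-≤ a≤b c≤d)

_⨾_⊢[_]_↓_ : Ctx → Ctx → Pol → Form → ℕ → Set
Γ ⨾ Δ ⊢[ s ] C ↓ n = Σ (Γ ⨾ Δ ⊢[ s ] C) (λ d → height d ≤ n)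

↓-mono : ∀ {Γ Δ s C m n} → m ≤ n → Γ ⨾ Δ ⊢[ s ] C ↓ m → Γ ⨾ Δ ⊢[ s ] C ↓ n
↓-mono m≤n = map id (λ h → ≤-trans h m≤n)

strengthen-⊤ᵃ : ∀ {Γ Γ₀ Δ s C} → Γ ↭ ⊤′ ∷ Γ₀ → (d : Γ ⨾ Δ ⊢[ s ] C) →
                Γ₀ ⨾ Δ ⊢[ s ] C ↓ height d
strengthen-⊤ᵃ q (ax⁺ p) with ↭-distinct-heads q p (λ ())
... | _ , r , _ = ax⁺ r , z≤n
strengthen-⊤ᵃ q (ax⁻ p) = ax⁻ p , z≤n
strengthen-⊤ᵃ q (⊥L p) with ↭-distinct-heads q p (λ ())
... | _ , r , _ = ⊥L r , z≤n
strengthen-⊤ᵃ q (⊤L p) = ⊤L p , z≤n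
strengthen-⊤ᵃ q ⊥R⁻ = ⊥R⁻ , z≤n
strengthen-⊤ᵃ q ⊤R⁺ = ⊤R⁺ , z≤n
strengthen-⊤ᵃ q (∧R⁺ d e) = zip ∧R⁺ suc-⊔-mono-≤ (strengthen-⊤ᵃ q d) (strengthen-⊤ᵃ q e)
strengthen-⊤ᵃ q (∧R⁻₁ d) = map ∧R⁻₁ s≤s (strengthen-⊤ᵃ q d)
strengthen-⊤ᵃ q (∧R⁻₂ d) = map ∧R⁻₂ s≤s (strengthen-⊤ᵃ q d)
strengthen-⊤ᵃ q (∧Lᵃ {A = A} {B} p d) with ↭-distinct-heads q p (λ ())
... | _ , r , t = map (∧Lᵃ r) s≤s (strengthen-⊤ᵃ (↭-prep-under A (↭-prep-under B t)) d)
strengthen-⊤ᵃ q (∧Lᶜ p d e) = zip (∧Lᶜ p) suc-⊔-mono-≤ (strengthen-⊤ᵃ q d) (strengthen-⊤ᵃ q e)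
strengthen-⊤ᵃ q (∨R⁺₁ d) = map ∨R⁺₁ s≤s (strengthen-⊤ᵃ q d)
strengthen-⊤ᵃ q (∨R⁺₂ d) = map ∨R⁺₂ s≤s (strengthen-⊤ᵃ q d)
strengthen-⊤ᵃ q (∨R⁻ d e) = zip ∨R⁻ suc-⊔-mono-≤ (strengthen-⊤ᵃ q d) (strengthen-⊤ᵃ q e)
strengthen-⊤ᵃ q (∨Lᵃ {A = A} {B} p d e) with ↭-distinct-heads q p (λ ())
... | _ , r , t = zip (∨Lᵃ r) suc-⊔-mono-≤
  (strengthen-⊤ᵃ (↭-prep-under A t) d) (strengthen-⊤ᵃ (↭-prep-under B t) e)
strengthen-⊤ᵃ q (∨Lᶜ p d) = map (∨Lᶜ p) s≤s (strengthen-⊤ᵃ q d)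
strengthen-⊤ᵃ q (⇒R⁺ {A = A} d) = map ⇒R⁺ s≤s (strengthen-⊤ᵃ (↭-prep-under A q) d)
strengthen-⊤ᵃ q (⇒R⁻ d e) = zip ⇒R⁻ suc-⊔-mono-≤ (strengthen-⊤ᵃ q d) (strengthen-⊤ᵃ q e)
strengthen-⊤ᵃ q (⇒Lᵃ {B = B} p d e) with ↭-distinct-heads q p (λ ())
... | _ , r , t = zip (⇒Lᵃ r) suc-⊔-mono-≤
  (strengthen-⊤ᵃ q d) (strengthen-⊤ᵃ (↭-prep-under B t) e)
strengthen-⊤ᵃ q (⇒Lᶜ {A = A} p d) = map (⇒Lᶜ p) s≤s (strengthen-⊤ᵃ (↭-prep-under A q) d)
strengthen-⊤ᵃ q (-<R⁺ d e) = zip -<R⁺ suc-⊔-mono-≤ (strengthen-⊤ᵃ q d) (strengthen-⊤ᵃ q e)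
strengthen-⊤ᵃ q (-<R⁻ d) = map -<R⁻ s≤s (strengthen-⊤ᵃ q d)
strengthen-⊤ᵃ q (-<Lᵃ {A = A} p d) with ↭-distinct-heads q p (λ ())
... | _ , r , t = map (-<Lᵃ r) s≤s (strengthen-⊤ᵃ (↭-prep-under A t) d)
strengthen-⊤ᵃ q (-<Lᶜ p d e) = zip (-<Lᶜ p) suc-⊔-mono-≤ (strengthen-⊤ᵃ q d) (strengthen-⊤ᵃ q e)

strengthen-⊥ᶜ : ∀ {Γ Δ Δ₀ s C} → Δ ↭ ⊥′ ∷ Δ₀ → (d : Γ ⨾ Δ ⊢[ s ] C) →
                Γ ⨾ Δ₀ ⊢[ s ] C ↓ height d
strengthen-⊥ᶜ q (ax⁺ p) = ax⁺ p , z≤n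
strengthen-⊥ᶜ q (ax⁻ p) with ↭-distinct-heads q p (λ ())
... | _ , r , _ = ax⁻ r , z≤n
strengthen-⊥ᶜ q (⊥L p) = ⊥L p , z≤n
strengthen-⊥ᶜ q (⊤L p) with ↭-distinct-heads q p (λ ())
... | _ , r , _ = ⊤L r , z≤n
strengthen-⊥ᶜ q ⊥R⁻ = ⊥R⁻ , z≤n
strengthen-⊥ᶜ q ⊤R⁺ = ⊤R⁺ , z≤n
strengthen-⊥ᶜ q (∧R⁺ d e) = zip ∧R⁺ suc-⊔-mono-≤ (strengthen-⊥ᶜ q d) (strengthen-⊥ᶜ q e)
strengthen-⊥ᶜ q (∧R⁻₁ d) = map ∧R⁻₁ s≤s (strengthen-⊥ᶜ q d)
strengthen-⊥ᶜ q (∧R⁻₂ d) = map ∧R⁻₂ s≤s (strengthen-⊥ᶜ q d)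
strengthen-⊥ᶜ q (∧Lᵃ p d) = map (∧Lᵃ p) s≤s (strengthen-⊥ᶜ q d)
strengthen-⊥ᶜ q (∧Lᶜ {A = A} {B} p d e) with ↭-distinct-heads q p (λ ())
... | _ , r , t = zip (∧Lᶜ r) suc-⊔-mono-≤
  (strengthen-⊥ᶜ (↭-prep-under A t) d) (strengthen-⊥ᶜ (↭-prep-under B t) e)
strengthen-⊥ᶜ q (∨R⁺₁ d) = map ∨R⁺₁ s≤s (strengthen-⊥ᶜ q d)
strengthen-⊥ᶜ q (∨R⁺₂ d) = map ∨R⁺₂ s≤s (strengthen-⊥ᶜ q d)
strengthen-⊥ᶜ q (∨R⁻ d e) = zip ∨R⁻ suc-⊔-mono-≤ (strengthen-⊥ᶜ q d) (strengthen-⊥ᶜ q e)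
strengthen-⊥ᶜ q (∨Lᵃ p d e) = zip (∨Lᵃ p) suc-⊔-mono-≤ (strengthen-⊥ᶜ q d) (strengthen-⊥ᶜ q e)
strengthen-⊥ᶜ q (∨Lᶜ {A = A} {B} p d) with ↭-distinct-heads q p (λ ())
... | _ , r , t = map (∨Lᶜ r) s≤s (strengthen-⊥ᶜ (↭-prep-under A (↭-prep-under B t)) d)
strengthen-⊥ᶜ q (⇒R⁺ d) = map ⇒R⁺ s≤s (strengthen-⊥ᶜ q d)
strengthen-⊥ᶜ q (⇒R⁻ d e) = zip ⇒R⁻ suc-⊔-mono-≤ (strengthen-⊥ᶜ q d) (strengthen-⊥ᶜ q e)
strengthen-⊥ᶜ q (⇒Lᵃ p d e) = zip (⇒Lᵃ p) suc-⊔-mono-≤ (strengthen-⊥ᶜ q d) (strengthen-⊥ᶜ q e)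
strengthen-⊥ᶜ q (⇒Lᶜ {B = B} p d) with ↭-distinct-heads q p (λ ())
... | _ , r , t = map (⇒Lᶜ r) s≤s (strengthen-⊥ᶜ (↭-prep-under B t) d)
strengthen-⊥ᶜ q (-<R⁺ d e) = zip -<R⁺ suc-⊔-mono-≤ (strengthen-⊥ᶜ q d) (strengthen-⊥ᶜ q e)
strengthen-⊥ᶜ q (-<R⁻ {B = B} d) = map -<R⁻ s≤s (strengthen-⊥ᶜ (↭-prep-under B q) d)
strengthen-⊥ᶜ q (-<Lᵃ {B = B} p d) = map (-<Lᵃ p) s≤s (strengthen-⊥ᶜ (↭-prep-under B q) d)
strengthen-⊥ᶜ q (-<Lᶜ {A = A} p d e) with ↭-distinct-heads q p (λ ())
... | _ , r , t = zip (-<Lᶜ r) suc-⊔-mono-≤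
  (strengthen-⊥ᶜ q d) (strengthen-⊥ᶜ (↭-prep-under A t) e)

lemma3p2p2 : ∀ (n : ℕ) (Γ Δ : Ctx) (s : Pol) (C : Form) →
    (Σ ((⊤′ ∷ Γ) ⨾ Δ ⊢[ s ] C) (λ d → height d ≤ n)
      ⊎ Σ (Γ ⨾ (⊥′ ∷ Δ) ⊢[ s ] C) (λ d → height d ≤ n)) →
    Σ (Γ ⨾ Δ ⊢[ s ] C) (λ d → height d ≤ n)
lemma3p2p2 n Γ Δ s C (inj₁ (d , h)) = ↓-mono h (strengthen-⊤ᵃ refl d)
lemma3p2p2 n Γ Δ s C (inj₂ (d , h)) = ↓-mono h (strengthen-⊥ᶜ refl d)
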